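{- Let $k\ge 2$. If $n=p^a$, where $p$ is a prime and $a$ is a $k$-perfect number, then $n$ is $k$-multiplicatively $e$-perfect. If $n=p^a$, where $p$ is a prime and $a$ is a $k$-superperfect number, then $n$ is $k$-multiplicatively $e$-superperfect.
   Context: For $n=p_1^{a_1}\cdots p_r^{a_r}>1$ (prime factorization), a divisor $d$ of $n$ is an exponential divisor ($e$-divisor) if $d=p_1^{b_1}\cdots p_r^{b_r}$ with $b_i\mid a_i$ for all $i$; $T_e(n)$ denotes the product of all $e$-divisors of $n$. For $k\ge 2$, $n$ is $k$-multiplicatively $e$-perfect if $T_e(n)=n^k$, and $k$-multiplicatively $e$-superperfect if $T_e(T_e(n))=n^k$. A positive integer $a$ is $k$-perfect if $\sigma(a)=ka$ and $k$-superperfect if $\sigma(\sigma(a))=ka$, where $\sigma$ is the sum-of-divisors function. -}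

module Defs where

open import Data.Nat using (ℕ; zero; suc; _+_; _*_; _^_; _≤_; _<_; _/_)
open import Data.Nat.Divisibility using (_∣?_)
open import Data.Nat.Primality using (prime?)
open import Data.Nat.Properties using (_≟_)
open import Data.Bool using (Bool; true; false; _∧_; _∨_; not; if_then_else_)
open import Data.Bool.Properties using () renaming (_≟_ to _≟B_)
open import Data.List using (List; filter; upTo; map)
open import Data.Bool.ListAction using (and)
open import Data.Nat.ListAction using (sum; product)
open import Data.Product using (_×_)
open import Relation.Binary.PropositionalEquality using (_≡_)
open import Relation.Nullary.Decidable using (⌊_⌋; ¬?)

-- p-adic valuation of n (with fuel; fuel n is always sufficient).
-- For p ≤ 1 or n = 0 it returns 0 (never used in those cases for primes / n ≥ 1).
valF : ℕ → ℕ → ℕ → ℕ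
valF zero p n = 0
valF (suc f) zero n = 0
valF (suc f) (suc zero) n = 0
valF (suc f) (suc (suc q)) n =
  if ⌊ suc (suc q) ∣? n ⌋ ∧ not ⌊ n ≟ 0 ⌋
  then suc (valF f (suc (suc q)) (n / suc (suc q)))
  else 0

val : ℕ → ℕ → ℕ
val p n = valF n p n

range1 : ℕ → List ℕ
range1 n = map suc (upTo n)

-- d is an exponential divisor of n: d ∣ n and, for every prime p (p ≤ n suffices,
-- since a prime dividing d or n is ≤ n), the exponent of p in d divides the exponent of p in n.
-- (As in the paper, exponents b_i of an e-divisor satisfy b_i ∣ a_i; since 0 ∣ a only for a = 0,
-- d has the same prime support as n.)
isEDiv : ℕ → ℕ → Bool
isEDiv d n =
  ⌊ d ∣? n ⌋ ∧
  and (map (λ p → not ⌊ prime? p ⌋ ∨ ⌊ val p d ∣? val p n ⌋) (upTo (suc n)))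

Te : ℕ → ℕ
Te n = product (filter (λ d → isEDiv d n ≟B true) (range1 n))

σ : ℕ → ℕ
σ n = sum (filter (λ d → d ∣? n) (range1 n))

IsKPerfect : ℕ → ℕ → Set
IsKPerfect k a = 1 ≤ a × σ a ≡ k * a

IsKSuperperfect : ℕ → ℕ → Set
IsKSuperperfect k a = 1 ≤ a × σ (σ a) ≡ k * a

IsMultEPerfect : ℕ → ℕ → Set
IsMultEPerfect k n = Te n ≡ n ^ k

IsMultESuperperfect : ℕ → ℕ → Set
IsMultESuperperfect k n = Te (Te n) ≡ n ^ k

module Submission where

-- Let p be a prime and a ≥ 1.  The e-divisors of p^a are exactly the powers p^b with b ∣ a.
-- Hence, when the numbers 1, …, p^a are filtered for e-divisors of p^a (this is how T_e is
-- defined), only powers of p survive, and p^b survives exactly when b ∣ a.  Reading the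
-- filtered list as a list of exponents gives
--
--     T_e(p^a) = ∏_{b ∣ a} p^b = p^σ(a).                                               (★)
--
-- If σ(a) = k a, then T_e(p^a) = p^(k a) = (p^a)^k.  If σ(σ(a)) = k a, then σ(a) ≥ 1 (as
-- σ(0) = 0 and k a > 0), so (★) applied twice gives T_e(T_e(p^a)) = p^σ(σ(a)) = (p^a)^k.

open import Defs
open import Data.Nat using (ℕ; _≤_; _^_)
open import Data.Nat.Primality using (Prime)
open import Data.Product using (_×_)

open import Level using (Level)
open import Data.Nat
  using (zero; suc; 2+; _+_; _*_; _∸_; _<_; _/_; z≤n; s≤s; z<s; s≤s⁻¹; NonZero; >-nonZero; >-nonZero⁻¹; ≢-nonZero⁻¹; nonTrivial⇒n>1)
open import Data.Nat.Properties
open import Data.Nat.Divisibility using (_∣_; _∣?_; divides; ∣1⇒≡1; ∣⇒≤; ∣-refl; m∣m*n; *-cancelʳ-∣)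
open import Data.Nat.DivMod using (m*n/n≡m)
open import Data.Nat.Primality using (prime?; prime⇒irreducible; prime⇒nonTrivial; prime⇒nonZero)
open import Data.Nat.Coprimality using (Coprime; coprime-divisor)
open import Data.Nat.ListAction using (sum; product)
open import Data.Bool using (Bool; T; true; false; not; _∨_)
open import Data.Bool.ListAction using (and)
open import Data.Bool.Properties using (T-≡; T-∧) renaming (_≟_ to _≟B_)
open import Data.List using (List; []; _∷_; [_]; _++_; map; filter; upTo)
open import Data.List.Properties using (upTo-∷ʳ; map-++; map-upTo; ++-identityʳ; filter-++; filter-reject; filter-≐)
open import Data.List.Membership.Propositional.Properties using (∈-upTo⁺)
import Data.List.Relation.Unary.All as All
open import Data.List.Relation.Unary.All.Properties using (all⁺; all⁻)
open import Data.Product using (_,_; proj₁; proj₂; ∃-syntax)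
open import Data.Sum using (inj₁; inj₂)
open import Function using (_∘_; Equivalence)
open import Relation.Nullary using (¬_; yes; no; does; contradiction)
open import Relation.Nullary.Decidable using (⌊_⌋; toWitness; fromWitness)
open import Relation.Unary using (Pred; Decidable)
open import Relation.Binary.PropositionalEquality using (_≡_; _≢_; refl; sym; trans; cong; cong₂; subst; subst₂; module ≡-Reasoning)

open ≡-Reasoning

private
  variable
    ℓ : Level

range1-snoc : ∀ N → range1 (suc N) ≡ range1 N ++ [ suc N ]
range1-snoc N = trans (cong (map suc) (sym (upTo-∷ʳ N))) (map-++ suc (upTo N) [ N ])

upTo-suc : ∀ N → upTo (suc N) ≡ 0 ∷ range1 N
upTo-suc N = cong (0 ∷_) (sym (map-upTo suc N))

filter-map : ∀ {A B : Set} {P : Pred B ℓ} (P? : Decidable P) (f : A → B) (xs : List A) →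
             filter P? (map f xs) ≡ map f (filter (P? ∘ f) xs)
filter-map P? f [] = refl
filter-map P? f (x ∷ xs) with does (P? (f x))
... | true  = cong (f x ∷_) (filter-map P? f xs)
... | false = filter-map P? f xs

product-map-^ : ∀ q xs → product (map (q ^_) xs) ≡ q ^ sum xs
product-map-^ q [] = refl
product-map-^ q (x ∷ xs) =
  trans (cong (q ^ x *_) (product-map-^ q xs)) (sym (^-distribˡ-+-* q x (sum xs)))

sum-filter-0∷ : ∀ {P : Pred ℕ ℓ} (P? : Decidable P) xs → sum (filter P? (0 ∷ xs)) ≡ sum (filter P? xs)
sum-filter-0∷ P? xs with does (P? 0)
... | true  = refl
... | false = refl

prime>1 : ∀ {p} → Prime p → 1 < p
prime>1 {p} pp = nonTrivial⇒n>1 p {{prime⇒nonTrivial pp}}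

-- For q > 1, n < q^n; used to see that `val` is run with enough fuel.
n<q^n : ∀ {q} → 1 < q → ∀ n → n < q ^ n
n<q^n 1<q zero = z<s
n<q^n {q} 1<q (suc n) = ≤-<-trans (n<q^n 1<q n) (^-monoʳ-< q 1<q (n<1+n n))

no-power-strictly-between : ∀ {q j m} c → 1 < q → q ^ j < m → m < q ^ suc j → m ≢ q ^ c
no-power-strictly-between {q@(suc _)} {j} c _ lo hi refl with c ≤? j
... | yes c≤j = <⇒≱ lo (^-monoʳ-≤ q c≤j)
... | no  c≰j = <⇒≱ hi (^-monoʳ-≤ q (≰⇒> c≰j))

^-mono-∣ : ∀ q {b c} → b ≤ c → q ^ b ∣ q ^ c
^-mono-∣ q {b} {c} b≤c = divides (q ^ (c ∸ b)) (begin
  q ^ c               ≡⟨ cong (q ^_) (m+[n∸m]≡n b≤c) ⟨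
  q ^ (b + (c ∸ b))   ≡⟨ ^-distribˡ-+-* q b (c ∸ b) ⟩
  q ^ b * q ^ (c ∸ b) ≡⟨ *-comm (q ^ b) _ ⟩
  q ^ (c ∸ b) * q ^ b ∎)

¬∣prime⇒coprime : ∀ {p d} → Prime p → ¬ p ∣ d → Coprime d p
¬∣prime⇒coprime pp p∤d (i∣d , i∣p) with prime⇒irreducible pp i∣p
... | inj₁ i≡1 = i≡1
... | inj₂ refl = contradiction i∣d p∤d

∣prime^⇒power : ∀ {p} → Prime p → ∀ m {d} → d ∣ p ^ m → ∃[ c ] d ≡ p ^ c
∣prime^⇒power pp zero d∣1 = 0 , ∣1⇒≡1 d∣1
∣prime^⇒power {p} pp (suc m) {d} d∣p^[1+m] with p ∣? d
... | no p∤d = ∣prime^⇒power pp m (coprime-divisor (¬∣prime⇒coprime pp p∤d) d∣p^[1+m])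
... | yes (divides e refl) =
  let c , e≡p^c = ∣prime^⇒power pp m e∣p^m
  in suc c , trans (cong (_* p) e≡p^c) (*-comm (p ^ c) p)
  where
  e∣p^m : e ∣ p ^ m
  e∣p^m = *-cancelʳ-∣ p {{prime⇒nonZero pp}}
            (subst (e * p ∣_) (*-comm p (p ^ m)) d∣p^[1+m])

prime∤prime^ : ∀ {p q} → Prime p → Prime q → q ≢ p → ∀ m → ¬ q ∣ p ^ m
prime∤prime^ {p} pp pq q≢p m q∣p^m with ∣prime^⇒power pp m q∣p^m
... | zero , refl = <⇒≢ (prime>1 pq) refl
... | suc c , refl with prime⇒irreducible pq (m∣m*n (p ^ c))
...   | inj₁ p≡1 = <⇒≢ (prime>1 pp) (sym p≡1)
...   | inj₂ p≡q = q≢p (sym p≡q)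

valF-nondivisor : ∀ fuel s n → ¬ 2+ s ∣ n → valF fuel (2+ s) n ≡ 0
valF-nondivisor zero s n _ = refl
valF-nondivisor (suc fuel) s n q∤n with 2+ s ∣? n
... | yes q∣n = contradiction q∣n q∤n
... | no  _   = refl

valF-divisor : ∀ fuel s n → 2+ s ∣ n → n ≢ 0 →
               valF (suc fuel) (2+ s) n ≡ suc (valF fuel (2+ s) (n / 2+ s))
valF-divisor fuel s n q∣n n≢0 with 2+ s ∣? n | n ≟ 0
... | no q∤n | _        = contradiction q∣n q∤n
... | yes _  | yes n≡0  = contradiction n≡0 n≢0
... | yes _  | no _     = refl

valF-^ : ∀ s b fuel → b ≤ fuel → valF fuel (2+ s) (2+ s ^ b) ≡ b
valF-^ s zero fuel _ = valF-nondivisor fuel s 1 (λ q∣1 → <⇒≢ (s≤s (s≤s z≤n)) (sym (∣1⇒≡1 q∣1)))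
valF-^ s (suc b) (suc fuel) (s≤s b≤fuel) = begin
  valF (suc fuel) q (q ^ suc b)  ≡⟨ valF-divisor fuel s (q ^ suc b) (m∣m*n (q ^ b)) (≢-nonZero⁻¹ _ {{m^n≢0 q (suc b)}}) ⟩
  suc (valF fuel q (q * q ^ b / q)) ≡⟨ cong (λ x → suc (valF fuel q (x / q))) (*-comm q (q ^ b)) ⟩
  suc (valF fuel q (q ^ b * q / q)) ≡⟨ cong (λ x → suc (valF fuel q x)) (m*n/n≡m (q ^ b) q) ⟩
  suc (valF fuel q (q ^ b))      ≡⟨ cong suc (valF-^ s b fuel b≤fuel) ⟩
  suc b                          ∎
  where
  q : ℕ
  q = 2+ s

val-^ : ∀ {q} → 1 < q → ∀ b → val q (q ^ b) ≡ b
val-^ {2+ s} 1<q@(s≤s (s≤s z≤n)) b = valF-^ s b (2+ s ^ b) (<⇒≤ (n<q^n 1<q b))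

val-nondivisor : ∀ {q n} → 1 < q → ¬ q ∣ n → val q n ≡ 0
val-nondivisor {2+ s} {n} (s≤s (s≤s z≤n)) q∤n = valF-nondivisor n s n q∤n

eDivCondition : ℕ → ℕ → ℕ → Bool
eDivCondition d n q = not ⌊ prime? q ⌋ ∨ ⌊ val q d ∣? val q n ⌋

isEDiv-intro : ∀ {d n} → d ∣ n → (∀ q → Prime q → val q d ∣ val q n) → isEDiv d n ≡ true
isEDiv-intro {d} {n} d∣n vals =
  Equivalence.to T-≡ (Equivalence.from T-∧
    (fromWitness d∣n , all⁻ (eDivCondition d n) (All.universal atPrime (upTo (suc n)))))
  where
  atPrime : ∀ q → T (eDivCondition d n q)
  atPrime q with prime? q
  ... | no  _  = _
  ... | yes pq = fromWitness (vals q pq)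

isEDiv-elim : ∀ {d n} → isEDiv d n ≡ true → d ∣ n × (∀ q → Prime q → q ≤ n → val q d ∣ val q n)
isEDiv-elim {d} {n} e = toWitness {a? = d ∣? n} d∣n , λ q pq q≤n →
  atPrime q pq (All.lookup (all⁺ (eDivCondition d n) (upTo (suc n)) conditions) (∈-upTo⁺ (s≤s q≤n)))
  where
  d∣n : T ⌊ d ∣? n ⌋
  d∣n = proj₁ (Equivalence.to T-∧ (Equivalence.from T-≡ e))
  conditions : T (and (map (eDivCondition d n) (upTo (suc n))))
  conditions = proj₂ (Equivalence.to T-∧ (Equivalence.from T-≡ e))
  atPrime : ∀ q → Prime q → T (eDivCondition d n q) → val q d ∣ val q n
  atPrime q pq t with prime? q
  ... | no ¬pq = contradiction pq ¬pq
  ... | yes _  = toWitness t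

module EDivisorsOfPrimePower {p : ℕ} (pp : Prime p) (a : ℕ) .{{_ : NonZero a}} where

  eDiv⇒power : ∀ {d} → isEDiv d (p ^ a) ≡ true → ∃[ c ] d ≡ p ^ c
  eDiv⇒power e = ∣prime^⇒power pp a (proj₁ (isEDiv-elim e))

  -- comparing the valuations at p, which are b and a
  eDiv⇒∣ : ∀ {b} → isEDiv (p ^ b) (p ^ a) ≡ true → b ∣ a
  eDiv⇒∣ {b} e = subst₂ _∣_ (val-^ (prime>1 pp) b) (val-^ (prime>1 pp) a)
                   (proj₂ (isEDiv-elim e) p pp p≤p^a)
    where
    p≤p^a : p ≤ p ^ a
    p≤p^a = subst (_≤ p ^ a) (*-identityʳ p)
              (^-monoʳ-≤ p {{prime⇒nonZero pp}} (>-nonZero⁻¹ a))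

  -- p^b ∣ p^a as b ≤ a; at p the valuations are b ∣ a, at other primes both are 0
  ∣⇒eDiv : ∀ {b} → b ∣ a → isEDiv (p ^ b) (p ^ a) ≡ true
  ∣⇒eDiv {b} b∣a = isEDiv-intro (^-mono-∣ p (∣⇒≤ b∣a)) valuations
    where
    valuations : ∀ q → Prime q → val q (p ^ b) ∣ val q (p ^ a)
    valuations q pq with q ≟ p
    ... | yes refl = subst₂ _∣_ (sym (val-^ (prime>1 pp) b)) (sym (val-^ (prime>1 pp) a)) b∣a
    ... | no q≢p   = subst₂ _∣_ (sym (val0 b)) (sym (val0 a)) ∣-refl
      where
      val0 : ∀ m → val q (p ^ m) ≡ 0
      val0 m = val-nondivisor (prime>1 pq) (prime∤prime^ pp pq q≢p m)

-- Sparse filter lemma: if R holds only at powers of q > 1, then filtering 1, …, q^j for R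
-- is the same as filtering the powers q^0, …, q^j for R.
module SparseFilter {R : Pred ℕ ℓ} (R? : Decidable R) {q : ℕ} (1<q : 1 < q)
                    (onlyPowers : ∀ {m} → R m → ∃[ c ] m ≡ q ^ c) where

  private instance
    q≢0 : NonZero q
    q≢0 = >-nonZero (<-trans z<s 1<q)

  rejects-between : ∀ {j m} → q ^ j < m → m < q ^ suc j → filter R? [ m ] ≡ []
  rejects-between {j} lo hi = filter-reject R? λ Rm →
    let c , m≡q^c = onlyPowers Rm in no-power-strictly-between {j = j} c 1<q lo hi m≡q^c

  filter-between : ∀ j m → q ^ j ≤ m → m < q ^ suc j →
                   filter R? (range1 m) ≡ filter R? (range1 (q ^ j))
  filter-between j zero lo _ = contradiction lo (<⇒≱ (m^n>0 q j))
  filter-between j (suc m) lo hi with q ^ j ≤? m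
  ... | no q^j≰m = -- then 1 + m = q^j
                   cong (filter R? ∘ range1) (≤-antisym (≰⇒> q^j≰m) lo)
  ... | yes q^j≤m = begin
    filter R? (range1 (suc m))                  ≡⟨ cong (filter R?) (range1-snoc m) ⟩
    filter R? (range1 m ++ [ suc m ])           ≡⟨ filter-++ R? (range1 m) [ suc m ] ⟩
    filter R? (range1 m) ++ filter R? [ suc m ] ≡⟨ cong₂ _++_ (filter-between j m q^j≤m (<-trans (n<1+n m) hi))
                                                              (rejects-between {j} (s≤s q^j≤m) hi) ⟩
    filter R? (range1 (q ^ j)) ++ []            ≡⟨ ++-identityʳ _ ⟩
    filter R? (range1 (q ^ j))                  ∎

  filter-next-power : ∀ j → filter R? (range1 (q ^ suc j)) ≡ filter R? (range1 (q ^ j)) ++ filter R? [ q ^ suc j ]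
  filter-next-power j = upToLast (q ^ suc j) refl
    where
    upToLast : ∀ N → N ≡ q ^ suc j → filter R? (range1 N) ≡ filter R? (range1 (q ^ j)) ++ filter R? [ N ]
    upToLast zero 0≡q^[1+j] = contradiction (sym 0≡q^[1+j]) (≢-nonZero⁻¹ _ {{m^n≢0 q (suc j)}})
    upToLast (suc m) 1+m≡q^[1+j] = begin
      filter R? (range1 (suc m))                  ≡⟨ cong (filter R?) (range1-snoc m) ⟩
      filter R? (range1 m ++ [ suc m ])           ≡⟨ filter-++ R? (range1 m) [ suc m ] ⟩
      filter R? (range1 m) ++ filter R? [ suc m ] ≡⟨ cong (_++ filter R? [ suc m ]) (filter-between j m lo hi) ⟩
      filter R? (range1 (q ^ j)) ++ filter R? [ suc m ] ∎
      where
      hi : m < q ^ suc j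
      hi = subst (m <_) 1+m≡q^[1+j] (n<1+n m)
      lo : q ^ j ≤ m
      lo = s≤s⁻¹ (subst (q ^ j <_) (sym 1+m≡q^[1+j]) (^-monoʳ-< q 1<q (n<1+n j)))

  filter-powers : ∀ j → filter R? (range1 (q ^ j)) ≡ filter R? (map (q ^_) (upTo (suc j)))
  filter-powers zero = refl
  filter-powers (suc j) = begin
    filter R? (range1 (q ^ suc j))                                   ≡⟨ filter-next-power j ⟩
    filter R? (range1 (q ^ j)) ++ filter R? [ q ^ suc j ]            ≡⟨ cong (_++ filter R? [ q ^ suc j ]) (filter-powers j) ⟩
    filter R? (map (q ^_) (upTo (suc j))) ++ filter R? [ q ^ suc j ] ≡⟨ filter-++ R? (map (q ^_) (upTo (suc j))) [ q ^ suc j ] ⟨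
    filter R? (map (q ^_) (upTo (suc j)) ++ [ q ^ suc j ])           ≡⟨ cong (filter R?) (map-++ (q ^_) (upTo (suc j)) [ suc j ]) ⟨
    filter R? (map (q ^_) (upTo (suc j) ++ [ suc j ]))               ≡⟨ cong (filter R? ∘ map (q ^_)) (upTo-∷ʳ (suc j)) ⟩
    filter R? (map (q ^_) (upTo (suc (suc j))))                      ∎

Te-prime^ : ∀ {p} → Prime p → ∀ a → .{{NonZero a}} → Te (p ^ a) ≡ p ^ σ a
Te-prime^ {p} pp a = begin
  Te (p ^ a)                                              ≡⟨⟩
  product (filter E? (range1 (p ^ a)))                    ≡⟨ cong product (filter-powers a) ⟩
  product (filter E? (map (p ^_) (upTo (suc a))))         ≡⟨ cong product (filter-map E? (p ^_) (upTo (suc a))) ⟩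
  product (map (p ^_) (filter (E? ∘ (p ^_)) (upTo (suc a))))
                                   ≡⟨ cong (product ∘ map (p ^_)) (filter-≐ (E? ∘ (p ^_)) (_∣? a) (eDiv⇒∣ , ∣⇒eDiv) (upTo (suc a))) ⟩
  product (map (p ^_) (filter (_∣? a) (upTo (suc a))))    ≡⟨ product-map-^ p (filter (_∣? a) (upTo (suc a))) ⟩
  p ^ sum (filter (_∣? a) (upTo (suc a)))                 ≡⟨ cong (λ xs → p ^ sum (filter (_∣? a) xs)) (upTo-suc a) ⟩
  p ^ sum (filter (_∣? a) (0 ∷ range1 a))                 ≡⟨ cong (p ^_) (sum-filter-0∷ (_∣? a) (range1 a)) ⟩
  p ^ σ a                                                 ∎
  where
  open EDivisorsOfPrimePower pp a
  E? : Decidable (λ d → isEDiv d (p ^ a) ≡ true)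
  E? d = isEDiv d (p ^ a) ≟B true
  open SparseFilter E? (prime>1 pp) eDiv⇒power

-- σ(0) = 0, so a nonzero value of σ has a nonzero argument.
σ-nonZero⁻¹ : ∀ m → NonZero (σ m) → NonZero m
σ-nonZero⁻¹ zero    σ0≢0 = σ0≢0
σ-nonZero⁻¹ (suc m) _    = _

theorem2p8 : (k : ℕ) → 2 ≤ k → (p a : ℕ) → Prime p →
    (IsKPerfect k a → IsMultEPerfect k (p ^ a)) ×
    (IsKSuperperfect k a → IsMultESuperperfect k (p ^ a))
theorem2p8 k 2≤k p a pp = perfect , superperfect
  where
  p^[k*a] : ∀ {x} → x ≡ k * a → p ^ x ≡ (p ^ a) ^ k
  p^[k*a] refl = trans (cong (p ^_) (*-comm k a)) (sym (^-*-assoc p a k))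

  perfect : IsKPerfect k a → IsMultEPerfect k (p ^ a)
  perfect (1≤a , σa≡ka) = trans (Te-prime^ pp a {{>-nonZero 1≤a}}) (p^[k*a] σa≡ka)

  superperfect : IsKSuperperfect k a → IsMultESuperperfect k (p ^ a)
  superperfect (1≤a , σσa≡ka) = begin
    Te (Te (p ^ a)) ≡⟨ cong Te (Te-prime^ pp a) ⟩
    Te (p ^ σ a)    ≡⟨ Te-prime^ pp (σ a) {{σa≢0}} ⟩
    p ^ σ (σ a)     ≡⟨ p^[k*a] σσa≡ka ⟩
    (p ^ a) ^ k     ∎
    where
    instance
      a≢0 : NonZero a
      a≢0 = >-nonZero 1≤a
      k≢0 : NonZero k
      k≢0 = >-nonZero (<-trans z<s 2≤k)
    σa≢0 : NonZero (σ a)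
    σa≢0 = σ-nonZero⁻¹ (σ a) (subst NonZero (sym σσa≡ka) (m*n≢0 k a))
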